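{- Let $w$ and $w'$ be observations with letters $(I_i,\sigma_i,\rho_i)$ for $i\in\mathit{pos}(w)$ and $(I'_j,\sigma'_j,\rho'_j)$ for $j\in\mathit{pos}(w')$. If $w\sqsubseteq w'$, then there is a monotonic function $\pi:\mathit{pos}(w')\to\mathit{pos}(w)$ such that for all $j\in\mathit{pos}(w')$: (R1) $I'_j\subseteq I_{\pi(j)}$; (R2) $\sigma_{\pi(j)}\sqsubseteq\sigma'_j$; (R3) $\rho_{\pi(j)}\sqsubseteq\rho'_j$.
   Context: Fix a nonempty data domain $D$, predicate symbols $P$ with arities $\iota(p)$, and registers $R$. An observation is a finite word $w=(I_0,\sigma_0,\rho_0)\dots(I_n,\sigma_n,\rho_n)$ whose positions form $\mathit{pos}(w)=\{0,\dots,n\}$, where the $I_i$ are pairwise disjoint intervals of $\mathbb{Q}_{\ge0}$ ordered increasingly, each $\sigma_i$ is a partial function on $P$ with $\sigma_i(p)\subseteq D^{\iota(p)}$, and each $\rho_i:R\rightharpoonup D$ is partial; observations are exactly the words obtained from $([0,\infty),[\,],[\,])$ ($[\,]$ = nowhere-defined function) by finitely many applications of: (T1) replacing a letter $(J,[\,],[\,])$ with $J$ not a singleton and $\tau\in J$ by the letters $(J\cap[0,\tau),[\,],[\,])$, $(\{\tau\},[\,],[\,])$, $(J\cap(\tau,\infty),[\,],[\,])$, omitting those with empty interval; (T2) deleting a letter whose interval is not a singleton; (T3) replacing a letter $(\{\tau\},\sigma,\rho)$ by $(\{\tau\},\sigma',\rho')$ with $\sigma\sqsubseteq\sigma'$,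 $\rho\sqsubseteq\rho'$. For observations, $w\sqsubseteq w'$ holds iff $w'$ is obtained from $w$ by finitely many (possibly zero) such transformations. For partial functions, $f\sqsubseteq g$ means $\mathrm{def}(f)\subseteq\mathrm{def}(g)$ and $f(a)=g(a)$ for all $a\in\mathrm{def}(f)$. -}

module Defs where

open import Level using (Level; 0ℓ) renaming (suc to lsuc)
open import Data.Nat using (ℕ)
open import Data.Fin using (Fin)
open import Data.Maybe using (Maybe; just; nothing)
open import Data.List using (List; []; _∷_; _++_; map; length; lookup)
open import Data.Vec using (Vec)
open import Data.Product using (Σ; ∃; _×_; _,_)
open import Data.Rational using (ℚ; 0ℚ; _≤_; _<_)
open import Relation.Nullary using (¬_)
open import Relation.Unary using (Pred)
open import Relation.Binary.PropositionalEquality using (_≡_)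
open import Relation.Binary.Construct.Closure.ReflexiveTransitive using (Star)

Partial : {a b : Level} → (A : Set a) → (A → Set b) → Set (a Level.⊔ b)
Partial A B = (x : A) → Maybe (B x)

_⊑ₚ_ : {a b : Level} {A : Set a} {B : A → Set b} → Partial A B → Partial A B → Set (a Level.⊔ b)
f ⊑ₚ g = ∀ x v → f x ≡ just v → g x ≡ just v

∅ₚ : {a b : Level} {A : Set a} {B : A → Set b} → Partial A B
∅ₚ _ = nothing

IsEmptyₚ : {a b : Level} {A : Set a} {B : A → Set b} → Partial A B → Set (a Level.⊔ b)
IsEmptyₚ f = ∀ x → f x ≡ nothing

-- Subsets of ℚ (intervals are represented by their sets of points).
Interval : Set₁
Interval = Pred ℚ 0ℓ

_⊆ᵢ_ : Interval → Interval → Set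
I ⊆ᵢ J = ∀ q → I q → J q

_∩ᵢ_ : Interval → Interval → Interval
(I ∩ᵢ J) q = I q × J q

nonneg : Interval
nonneg q = 0ℚ ≤ q

below : ℚ → Interval
below τ q = (0ℚ ≤ q) × (q < τ)

above : ℚ → Interval
above τ q = τ < q

single : ℚ → Interval
single τ q = q ≡ τ

IsSingletonAt : Interval → ℚ → Set
IsSingletonAt I τ = ∀ q → (I q → q ≡ τ) × (q ≡ τ → I q)

IsSingleton : Interval → Set
IsSingleton I = ∃ λ τ → IsSingletonAt I τ

NonEmpty : Interval → Set
NonEmpty I = ∃ λ q → I q

module Obs (D : Set) (P : Set) (ι : P → ℕ) (R : Set) where

  Sig : Set₁
  Sig = Partial P (λ p → Pred (Vec D (ι p)) 0ℓ)

  Reg : Set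
  Reg = Partial R (λ _ → D)

  record Letter : Set₁ where
    constructor ⟨_,_,_⟩
    field
      I : Interval
      σ : Sig
      ρ : Reg
  open Letter public

  Word : Set₁
  Word = List Letter

  Pos : Word → Set
  Pos w = Fin (length w)

  data OmitEmpty : List Interval → List Interval → Set₁ where
    []   : OmitEmpty [] []
    keep : ∀ {J Js Ks} → NonEmpty J → OmitEmpty Js Ks → OmitEmpty (J ∷ Js) (J ∷ Ks)
    drop : ∀ {J Js Ks} → ¬ NonEmpty J → OmitEmpty Js Ks → OmitEmpty (J ∷ Js) Ks

  blank : Interval → Letter
  blank J = ⟨ J , ∅ₚ , ∅ₚ ⟩

  data Step : Word → Word → Set₁ where
    T1 : ∀ (u v : Word) (ℓ : Letter) (τ : ℚ) (Ks : List Interval)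
         → IsEmptyₚ (σ ℓ) → IsEmptyₚ (ρ ℓ)
         → ¬ IsSingleton (I ℓ) → I ℓ τ
         → OmitEmpty ((I ℓ ∩ᵢ below τ) ∷ single τ ∷ (I ℓ ∩ᵢ above τ) ∷ []) Ks
         → Step (u ++ ℓ ∷ v) (u ++ map blank Ks ++ v)
    T2 : ∀ (u v : Word) (ℓ : Letter)
         → ¬ IsSingleton (I ℓ)
         → Step (u ++ ℓ ∷ v) (u ++ v)
    T3 : ∀ (u v : Word) (J : Interval) (τ : ℚ) (s s' : Sig) (r r' : Reg)
         → IsSingletonAt J τ → s ⊑ₚ s' → r ⊑ₚ r'
         → Step (u ++ ⟨ J , s , r ⟩ ∷ v) (u ++ ⟨ J , s' , r' ⟩ ∷ v)

  initial : Word
  initial = ⟨ nonneg , ∅ₚ , ∅ₚ ⟩ ∷ []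

  _⊑_ : Word → Word → Set₁
  _⊑_ = Star Step

  IsObservation : Word → Set₁
  IsObservation w = initial ⊑ w

module Submission where

-- Write ℓ ≼ ℓ' ("ℓ' refines ℓ") when the interval of ℓ'
-- is contained in that of ℓ and the valuations of ℓ' extend those of ℓ.  The
-- theorem asks for a monotone map π : pos(w') → pos(w) with
-- lookup w (π j) ≼ lookup w' j for every j; call such a π an embedding of
-- w' into w.  Embeddings compose, so the existence of an embedding is a
-- preorder on words, and it suffices to embed w' into w for a single
-- transformation step w → w' (then fold over the chain w ⊑ w').

open import Defs
open import Level using (Level; _⊔_)
open import Data.Nat using (ℕ; z≤n; s≤s)
open import Data.Fin using (Fin; _≤_; zero; suc)
open import Data.List using (List; []; _∷_; _++_; map; length; lookup)
open import Data.List.Relation.Unary.All as All using (All; []; _∷_)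
open import Data.List.Relation.Unary.All.Properties using (map⁺)
open import Data.Product using (Σ; _×_; _,_; proj₁)
open import Relation.Binary.PropositionalEquality using (sym; trans; subst)
open import Relation.Binary.Construct.Closure.ReflexiveTransitive using (fold)

module Covering {a r : Level} {A : Set a} (_≼_ : A → A → Set r) where

  Embedding : List A → List A → Set r
  Embedding w w' = Σ (Fin (length w') → Fin (length w)) λ π →
    (∀ j k → j ≤ k → π j ≤ π k) × (∀ j → lookup w (π j) ≼ lookup w' j)

  embedding-trans : (∀ {x y z} → x ≼ y → y ≼ z → x ≼ z) →
                    ∀ {u v w} → Embedding u v → Embedding v w → Embedding u w
  embedding-trans ≼-trans (π , π-mono , π-refines) (π' , π'-mono , π'-refines) =
    (λ j → π (π' j)) ,
    (λ j k j≤k → π-mono (π' j) (π' k) (π'-mono j k j≤k)) ,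
    (λ j → ≼-trans (π-refines (π' j)) (π'-refines j))

  -- A cover of w' by w scans both words from the left: the current letter
  -- of w is either abandoned (next) or used to cover the current letter of
  -- w' and kept for the following ones (cover).
  data Cover : List A → List A → Set (a ⊔ r) where
    []    : Cover [] []
    next  : ∀ {x w w'} → Cover w w' → Cover (x ∷ w) w'
    cover : ∀ {x x' w w'} → x ≼ x' → Cover (x ∷ w) w' → Cover (x ∷ w) (x' ∷ w')

  positions : ∀ {w w'} → Cover w w' → Fin (length w') → Fin (length w)
  positions (next c)      j       = suc (positions c j)
  positions (cover _ _)   zero    = zero
  positions (cover _ c)   (suc j) = positions c j

  positions-monotone : ∀ {w w'} (c : Cover w w') j k → j ≤ k → positions c j ≤ positions c k
  positions-monotone (next c)    j       k       j≤k       = s≤s (positions-monotone c j k j≤k)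
  positions-monotone (cover _ _) zero    k       _         = z≤n
  positions-monotone (cover _ c) (suc j) (suc k) (s≤s j≤k) = positions-monotone c j k j≤k

  positions-refine : ∀ {w w'} (c : Cover w w') j → lookup w (positions c j) ≼ lookup w' j
  positions-refine (next c)      j       = positions-refine c j
  positions-refine (cover x≼x' _) zero    = x≼x'
  positions-refine (cover _ c)   (suc j) = positions-refine c j

  cover⇒embedding : ∀ {w w'} → Cover w w' → Embedding w w'
  cover⇒embedding c = positions c , positions-monotone c , positions-refine c

  module Reflexive (≼-refl : ∀ {x} → x ≼ x) where

    cover-refl : ∀ w → Cover w w
    cover-refl []      = []
    cover-refl (x ∷ w) = cover ≼-refl (next (cover-refl w))

    cover-prefix : ∀ u {w w'} → Cover w w' → Cover (u ++ w) (u ++ w')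
    cover-prefix []      c = c
    cover-prefix (x ∷ u) c = cover ≼-refl (next (cover-prefix u c))

    cover-skip : ∀ x w → Cover (x ∷ w) w
    cover-skip x w = next (cover-refl w)

    cover-split : ∀ x w {xs} → All (x ≼_) xs → Cover (x ∷ w) (xs ++ w)
    cover-split x w []             = cover-skip x w
    cover-split x w (x≼x' ∷ x≼xs) = cover x≼x' (cover-split x w x≼xs)

⊑ₚ-refl : ∀ {a b} {A : Set a} {B : A → Set b} {f : Partial A B} → f ⊑ₚ f
⊑ₚ-refl x v fx≡v = fx≡v

⊑ₚ-trans : ∀ {a b} {A : Set a} {B : A → Set b} {f g h : Partial A B} →
           f ⊑ₚ g → g ⊑ₚ h → f ⊑ₚ h
⊑ₚ-trans f⊑g g⊑h x v fx≡v = g⊑h x v (f⊑g x v fx≡v)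

empty-⊑ₚ : ∀ {a b} {A : Set a} {B : A → Set b} {f g : Partial A B} →
           IsEmptyₚ f → f ⊑ₚ g
empty-⊑ₚ f-empty x v fx≡v with () ← trans (sym (f-empty x)) fx≡v

module Letters (D P : Set) (ι : P → ℕ) (R : Set) where
  open Obs D P ι R

  omit-all : ∀ {Q : Interval → Set} {Js Ks} → OmitEmpty Js Ks → All Q Js → All Q Ks
  omit-all []           []       = []
  omit-all (keep _ omit) (q ∷ qs) = q ∷ omit-all omit qs
  omit-all (drop _ omit) (_ ∷ qs) = omit-all omit qs

  _≼_ : Letter → Letter → Set₁
  ℓ ≼ ℓ' = (I ℓ' ⊆ᵢ I ℓ) × (σ ℓ ⊑ₚ σ ℓ') × (ρ ℓ ⊑ₚ ρ ℓ')

  ≼-refl : ∀ {ℓ} → ℓ ≼ ℓ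
  ≼-refl = (λ q q∈I → q∈I) , ⊑ₚ-refl , ⊑ₚ-refl

  ≼-trans : ∀ {ℓ ℓ' ℓ''} → ℓ ≼ ℓ' → ℓ' ≼ ℓ'' → ℓ ≼ ℓ''
  ≼-trans (I'⊆I , σ⊑σ' , ρ⊑ρ') (I''⊆I' , σ'⊑σ'' , ρ'⊑ρ'') =
    (λ q q∈I'' → I'⊆I q (I''⊆I' q q∈I'')) ,
    ⊑ₚ-trans σ⊑σ' σ'⊑σ'' , ⊑ₚ-trans ρ⊑ρ' ρ'⊑ρ''

  open Covering _≼_
  open Covering.Reflexive _≼_ ≼-refl

  blank-refines : ∀ ℓ {K} → IsEmptyₚ (σ ℓ) → IsEmptyₚ (ρ ℓ) → K ⊆ᵢ I ℓ → ℓ ≼ blank K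
  blank-refines ℓ σ-empty ρ-empty K⊆I = K⊆I , empty-⊑ₚ σ-empty , empty-⊑ₚ ρ-empty

  split-pieces-⊆ : ∀ J τ → J τ →
                   All (_⊆ᵢ J) ((J ∩ᵢ below τ) ∷ single τ ∷ (J ∩ᵢ above τ) ∷ [])
  split-pieces-⊆ J τ τ∈J =
    (λ q → proj₁) ∷ (λ q q≡τ → subst J (sym q≡τ) τ∈J) ∷ (λ q → proj₁) ∷ []

  step-cover : ∀ {w w'} → Step w w' → Cover w w'
  step-cover (T1 u v ℓ τ Ks σ-empty ρ-empty _ τ∈I omit) =
    cover-prefix u (cover-split ℓ v (map⁺ (All.map (blank-refines ℓ σ-empty ρ-empty) pieces⊆I)))
    where
      pieces⊆I : All (_⊆ᵢ I ℓ) Ks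
      pieces⊆I = omit-all omit (split-pieces-⊆ (I ℓ) τ τ∈I)
  step-cover (T2 u v ℓ _) = cover-prefix u (cover-skip ℓ v)
  step-cover (T3 u v J τ s s' r r' _ s⊑s' r⊑r') =
    cover-prefix u (cover ((λ q q∈J → q∈J) , s⊑s' , r⊑r') (cover-skip ⟨ J , s , r ⟩ v))

  ⊑⇒embedding : ∀ {w w'} → w ⊑ w' → Embedding w w'
  ⊑⇒embedding = fold Embedding
    (λ {u} {v} {w} step v↪w →
       embedding-trans ≼-trans {u} {v} {w} (cover⇒embedding (step-cover step)) v↪w)
    (λ {w} → cover⇒embedding (cover-refl w))

mainTheorem3 : (D P R : Set) (ι : P → ℕ) → D →
    let open Obs D P ι R in
    (w w' : Word) → IsObservation w → IsObservation w' → w ⊑ w' →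
    Σ (Pos w' → Pos w) λ π →
      (∀ j k → j ≤ k → π j ≤ π k) ×
      (∀ j → (I (lookup w' j) ⊆ᵢ I (lookup w (π j)))
           × (σ (lookup w (π j)) ⊑ₚ σ (lookup w' j))
           × (ρ (lookup w (π j)) ⊑ₚ ρ (lookup w' j)))
mainTheorem3 D P R ι _ w w' _ _ w⊑w' = Letters.⊑⇒embedding D P ι R w⊑w'
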